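{- Let $\mathfrak X$ be a homogeneous tree of degree $q+1$ ($q\geq1$) and let $k,\ell$ be relatively prime positive integers. For all $f,g,h\in\mathcal F(\mathfrak X)$, the condition $$U_{k-1}(\mu_1)\big(g+U_{\ell-2}(\mu_1)f\big)=U_{\ell-1}(\mu_1)\big(h+U_{k-2}(\mu_1)f\big)$$ is necessary and sufficient for the existence of a unique wave $\{f_j\}_{j\in\mathbb Z}$ with $f_0=f$, $f_\ell=g$, and $f_k=h$.
   Context: $\mathfrak X$ is a tree in which every vertex has exactly $q+1$ edges; $\mathcal F(\mathfrak X)$ is the space of complex-valued functions on its vertices; $\mu_1f(v)=\frac{1}{q+1}\sum_{w\text{ adjacent to }v}f(w)$. A wave is a family $\{f_j\}_{j\in\mathbb Z}$ in $\mathcal F(\mathfrak X)$ with $\mu_1f_j=\frac{f_{j+1}+f_{j-1}}{2}$ for all $j\in\mathbb Z$. $U_n$: Chebyshev polynomials of the second kind, $U_0=1$, $U_1(x)=2x$, $U_n=2xU_{n-1}-U_{n-2}$, with $U_{ -n-1}=-U_{n-1}$ for $n\geq0$ (so $U_{ -1}=0$, $U_{ -2}=-1$); polynomials are applied to the operator $\mu_1$. -}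

module Defs where

open import Level using (Level; _⊔_) renaming (suc to lsuc)
open import Algebra.Bundles using (CommutativeRing)
open import Data.Nat using (ℕ; zero; suc)
open import Data.Integer using (ℤ; +_; -[1+_]) renaming (_+_ to _+ℤ_; _-_ to _-ℤ_)
open import Data.Fin using (Fin; _≟_)
open import Data.List using (List; []; _∷_; map; foldr; allFin)
open import Data.Bool using (Bool; true; false; not; _∧_; T)
open import Data.Unit using (tt)
open import Data.Product using (Σ; _,_; proj₁; _×_)
open import Relation.Nullary using (¬_; yes; no; Dec)
open import Relation.Binary.PropositionalEquality using (_≡_)
open import Data.Empty using (⊥-elim)
open import Relation.Nullary.Decidable using (⌊_⌋)

-- Scalars: a field of characteristic zero (stand-in for ℂ)

ringℕ : {c ℓ : Level} (R : CommutativeRing c ℓ) → ℕ → CommutativeRing.Carrier R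
ringℕ R zero    = CommutativeRing.0# R
ringℕ R (suc n) = CommutativeRing._+_ R (CommutativeRing.1# R) (ringℕ R n)

record CharZeroField (c ℓ : Level) : Set (lsuc (c ⊔ ℓ)) where
  field
    commutativeRing : CommutativeRing c ℓ
  open CommutativeRing commutativeRing public

  fromℕ : ℕ → Carrier
  fromℕ = ringℕ commutativeRing

  field
    inverse  : (x : Carrier) → ¬ (x ≈ 0#) → Σ Carrier (λ y → x * y ≈ 1#)
    charZero : (n : ℕ) → ¬ (fromℕ (suc n) ≈ 0#)

  recipSuc : ℕ → Carrier
  recipSuc n = proj₁ (inverse (fromℕ (suc n)) (charZero n))

-- The homogeneous tree of degree q+1: the Cayley graph of the free
-- product of q+1 copies of ℤ/2, i.e. reduced words over the alphabet
-- Fin (q+1) (no two consecutive letters equal); w ~ a·w (with a·(a·w') = w').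

isReduced : {n : ℕ} → List (Fin n) → Bool
isReduced []            = true
isReduced (a ∷ [])      = true
isReduced (a ∷ b ∷ w)   = not ⌊ a ≟ b ⌋ ∧ isReduced (b ∷ w)

private
  ∧-right : (x y : Bool) → T (x ∧ y) → T y
  ∧-right true  y p = p
  ∧-right false y ()

  reduced-tail : {n : ℕ} (b : Fin n) (w : List (Fin n)) →
                 T (isReduced (b ∷ w)) → T (isReduced w)
  reduced-tail b []      p = tt
  reduced-tail b (c ∷ w) p = ∧-right (not ⌊ b ≟ c ⌋) (isReduced (c ∷ w)) p

  cons-ok : {A : Set} {x y : A} {r : Bool} (d : Dec (x ≡ y)) →
            ¬ (x ≡ y) → T r → T (not ⌊ d ⌋ ∧ r)
  cons-ok (yes e) ne p = ⊥-elim (ne e)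
  cons-ok (no _)  ne p = p

Vertex : ℕ → Set
Vertex q = Σ (List (Fin (suc q))) (λ w → T (isReduced w))

step : {q : ℕ} → Vertex q → Fin (suc q) → Vertex q
step ([]    , p) a = (a ∷ [] , tt)
step (b ∷ w , p) a with a ≟ b
... | yes _ = (w , reduced-tail b w p)
... | no  a≢b = (a ∷ b ∷ w , cons-ok (a ≟ b) a≢b p)

neighbours : {q : ℕ} → Vertex q → List (Vertex q)
neighbours {q} v = map (step v) (allFin (suc q))

module Tree {c ℓ : Level} (K : CharZeroField c ℓ) (q : ℕ) where
  open CharZeroField K

  𝓕 : Set c
  𝓕 = Vertex q → Carrier

  _≈𝓕_ : 𝓕 → 𝓕 → Set ℓ
  f ≈𝓕 g = ∀ v → f v ≈ g v

  _⊕_ : 𝓕 → 𝓕 → 𝓕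
  (f ⊕ g) v = f v + g v

  _⊖_ : 𝓕 → 𝓕 → 𝓕
  (f ⊖ g) v = f v - g v

  ⊝_ : 𝓕 → 𝓕
  (⊝ f) v = - f v

  zero𝓕 : 𝓕
  zero𝓕 v = 0#

  _·_ : Carrier → 𝓕 → 𝓕
  (a · f) v = a * f v

  μ₁ : 𝓕 → 𝓕
  μ₁ f v = recipSuc q * foldr _+_ 0# (map f (neighbours v))

  two : Carrier
  two = fromℕ 2

  Uℕ : ℕ → 𝓕 → 𝓕
  Uℕ zero          f = f
  Uℕ (suc zero)    f = two · μ₁ f
  Uℕ (suc (suc n)) f = (two · μ₁ (Uℕ (suc n) f)) ⊖ Uℕ n f

  U : ℤ → 𝓕 → 𝓕
  U (+ n)            f = Uℕ n f
  U -[1+ zero ]      f = zero𝓕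
  U -[1+ suc m ]     f = ⊝ Uℕ m f

  IsWave : (ℤ → 𝓕) → Set ℓ
  IsWave F = ∀ (j : ℤ) → μ₁ (F j) ≈𝓕 (recipSuc 1 · (F (j +ℤ + 1) ⊕ F (j -ℤ + 1)))

  WaveThrough : (k l : ℕ) (f g h : 𝓕) → (ℤ → 𝓕) → Set ℓ
  WaveThrough k l f g h F =
    IsWave F × (F (+ 0) ≈𝓕 f) × (F (+ l) ≈𝓕 g) × (F (+ k) ≈𝓕 h)

  ∃!Wave : (k l : ℕ) (f g h : 𝓕) → Set (c ⊔ ℓ)
  ∃!Wave k l f g h =
    Σ (ℤ → 𝓕) λ F → WaveThrough k l f g h F ×
      (∀ (F′ : ℤ → 𝓕) → WaveThrough k l f g h F′ → ∀ (j : ℤ) → F′ j ≈𝓕 F j)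

{-# OPTIONS --safe #-}
-- Writing T = 2μ₁, a wave is a solution of f (j+1) = T f j − f (j−1), so it is determined by f 0 and
-- f 1, namely f j = V j (T) f 1 − V (j−1) (T) f 0 where V (n+1) = U n.  The boundary conditions
-- f ℓ = g and f k = h thus say exactly that φ = f 1 solves V ℓ φ = a and V k φ = b, with
-- a = g + V (ℓ−1) f and b = h + V (k−1) f.  Since (V n) is a divisibility sequence satisfying
-- Cassini's identity, Bézout's identity for the coprime k, ℓ lifts to A V k + B V ℓ = 1 in ℤ[T].
-- Hence the system has at most the solution φ = A b + B a, and that is a solution precisely when
-- V k a = V ℓ b.
module Submission where

open import Defs
open import Level using (Level; _⊔_; 0ℓ)
open import Algebra.Bundles using (CommutativeRing; AbelianGroup)
import Algebra.Construct.Pointwise as Pointwise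
import Algebra.Properties.Ring as RingProperties
import Algebra.Properties.Group as GroupProperties
import Algebra.Properties.AbelianGroup as AbelianGroupProperties
open import Algebra.Morphism.Structures using (module MagmaMorphisms)
open MagmaMorphisms using (IsMagmaHomomorphism)
open import Algebra.Structures using (IsCommutativeRing)
import Algebra.Properties.Monoid.Mult.TCOptimised as MonoidMult
import Algebra.Properties.Semiring.Mult.TCOptimised as SemiringMult
import Algebra.Solver.Ring.AlmostCommutativeRing as ACR
import Algebra.Solver.Ring
open import Data.Nat as ℕ using (ℕ; zero; suc; _≤_)
import Data.Nat.Properties as ℕ
open import Data.Nat.Coprimality using (Coprime; coprime-Bézout)
open import Data.Nat.GCD using (module Bézout)
open import Data.Integer as ℤ using (ℤ; +_; -[1+_])
import Data.Integer.Properties as ℤ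
import Data.Sign as Sign
open import Data.List using (List; []; _∷_; foldr; map)
open import Data.Maybe as Maybe using (Maybe)
open import Data.Product using (Σ; ∃; ∃₂; _,_; proj₁; proj₂; _×_)
open import Function using (_∘_)
open import Function.Bundles using (_⇔_; mk⇔; Equivalence)
import Function.Properties.Equivalence as ⇔
open import Relation.Binary.Consequences using (dec⇒weaklyDec)
open import Relation.Binary.Core using (Rel)
open import Relation.Binary.PropositionalEquality as ≡ using (_≡_)

-- The ring solver for an arbitrary commutative ring, with coefficients from ℤ: their equality is
-- decidable, which the solver needs in order to cancel terms.
module IntegerCoefficientSolver {a b : Level} (R : CommutativeRing a b) where
  open CommutativeRing R
  open RingProperties ring using (-0#≈0#; -‿involutive; -‿distribˡ-*; -‿distribʳ-*; -‿+-comm)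
  open MonoidMult +-monoid using (×-homo-+; 1+×) renaming (_×_ to _×ᵣ_)
  open SemiringMult semiring using (×1-homo-*)
  open import Algebra.Properties.CommutativeSemigroup +-commutativeSemigroup using (interchange)
  open import Relation.Binary.Reasoning.Setoid setoid

  ⟦_⟧ℤ : ℤ → Carrier
  ⟦ + n ⟧ℤ      = n ×ᵣ 1#
  ⟦ -[1+ n ] ⟧ℤ = - (suc n ×ᵣ 1#)

  ⟦⟧ℤ-⊖ : ∀ m n → ⟦ m ℤ.⊖ n ⟧ℤ ≈ m ×ᵣ 1# - n ×ᵣ 1#
  ⟦⟧ℤ-⊖ m       zero    = sym (trans (+-congˡ -0#≈0#) (+-identityʳ _))
  ⟦⟧ℤ-⊖ zero    (suc n) = sym (+-identityˡ _)
  ⟦⟧ℤ-⊖ (suc m) (suc n) = begin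
    ⟦ suc m ℤ.⊖ suc n ⟧ℤ              ≡⟨ ≡.cong ⟦_⟧ℤ (ℤ.[1+m]⊖[1+n]≡m⊖n m n) ⟩
    ⟦ m ℤ.⊖ n ⟧ℤ                      ≈⟨ ⟦⟧ℤ-⊖ m n ⟩
    m ×ᵣ 1# - n ×ᵣ 1#                 ≈⟨ +-identityˡ _ ⟨
    0# + (m ×ᵣ 1# - n ×ᵣ 1#)          ≈⟨ +-congʳ (-‿inverseʳ 1#) ⟨
    (1# - 1#) + (m ×ᵣ 1# - n ×ᵣ 1#)   ≈⟨ interchange 1# (- 1#) _ _ ⟩
    (1# + m ×ᵣ 1#) + (- 1# - n ×ᵣ 1#) ≈⟨ +-congˡ (-‿+-comm 1# _) ⟩
    (1# + m ×ᵣ 1#) - (1# + n ×ᵣ 1#)   ≈⟨ +-cong (1+× m 1#) (-‿cong (1+× n 1#)) ⟨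
    suc m ×ᵣ 1# - suc n ×ᵣ 1#         ∎

  ⟦⟧ℤ-+ : ∀ i j → ⟦ i ℤ.+ j ⟧ℤ ≈ ⟦ i ⟧ℤ + ⟦ j ⟧ℤ
  ⟦⟧ℤ-+ (+ m)    (+ n)    = ×-homo-+ 1# m n
  ⟦⟧ℤ-+ (+ m)    -[1+ n ] = ⟦⟧ℤ-⊖ m (suc n)
  ⟦⟧ℤ-+ -[1+ m ] (+ n)    = trans (⟦⟧ℤ-⊖ n (suc m)) (+-comm _ _)
  ⟦⟧ℤ-+ -[1+ m ] -[1+ n ] = begin
    - (suc (suc (m ℕ.+ n)) ×ᵣ 1#)     ≡⟨ ≡.cong (λ k → - (k ×ᵣ 1#)) (ℕ.+-suc (suc m) n) ⟨
    - ((suc m ℕ.+ suc n) ×ᵣ 1#)       ≈⟨ -‿cong (×-homo-+ 1# (suc m) (suc n)) ⟩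
    - (suc m ×ᵣ 1# + suc n ×ᵣ 1#)     ≈⟨ -‿+-comm _ _ ⟨
    - (suc m ×ᵣ 1#) + - (suc n ×ᵣ 1#) ∎

  ⟦⟧ℤ-neg : ∀ i → ⟦ ℤ.- i ⟧ℤ ≈ - ⟦ i ⟧ℤ
  ⟦⟧ℤ-neg (+ zero)  = sym -0#≈0#
  ⟦⟧ℤ-neg (+ suc n) = refl
  ⟦⟧ℤ-neg -[1+ n ]  = sym (-‿involutive _)

  ⟦+◃⟧ℤ : ∀ n → ⟦ Sign.+ ℤ.◃ n ⟧ℤ ≈ n ×ᵣ 1#
  ⟦+◃⟧ℤ zero    = refl
  ⟦+◃⟧ℤ (suc n) = refl

  ⟦-◃⟧ℤ : ∀ n → ⟦ Sign.- ℤ.◃ n ⟧ℤ ≈ - (n ×ᵣ 1#)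
  ⟦-◃⟧ℤ zero    = sym -0#≈0#
  ⟦-◃⟧ℤ (suc n) = refl

  ⟦⟧ℤ-* : ∀ i j → ⟦ i ℤ.* j ⟧ℤ ≈ ⟦ i ⟧ℤ * ⟦ j ⟧ℤ
  ⟦⟧ℤ-* (+ m)    (+ n)    = trans (⟦+◃⟧ℤ (m ℕ.* n)) (×1-homo-* m n)
  ⟦⟧ℤ-* (+ m)    -[1+ n ] = begin
    ⟦ Sign.- ℤ.◃ (m ℕ.* suc n) ⟧ℤ ≈⟨ ⟦-◃⟧ℤ (m ℕ.* suc n) ⟩
    - ((m ℕ.* suc n) ×ᵣ 1#)       ≈⟨ -‿cong (×1-homo-* m (suc n)) ⟩
    - (m ×ᵣ 1# * suc n ×ᵣ 1#)     ≈⟨ -‿distribʳ-* _ _ ⟩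
    m ×ᵣ 1# * - (suc n ×ᵣ 1#)     ∎
  ⟦⟧ℤ-* -[1+ m ] (+ n)    = begin
    ⟦ Sign.- ℤ.◃ (suc m ℕ.* n) ⟧ℤ ≈⟨ ⟦-◃⟧ℤ (suc m ℕ.* n) ⟩
    - ((suc m ℕ.* n) ×ᵣ 1#)       ≈⟨ -‿cong (×1-homo-* (suc m) n) ⟩
    - (suc m ×ᵣ 1# * n ×ᵣ 1#)     ≈⟨ -‿distribˡ-* _ _ ⟩
    - (suc m ×ᵣ 1#) * n ×ᵣ 1#     ∎
  ⟦⟧ℤ-* -[1+ m ] -[1+ n ] = begin
    ⟦ Sign.+ ℤ.◃ (suc m ℕ.* suc n) ⟧ℤ ≈⟨ ⟦+◃⟧ℤ (suc m ℕ.* suc n) ⟩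
    (suc m ℕ.* suc n) ×ᵣ 1#           ≈⟨ ×1-homo-* (suc m) (suc n) ⟩
    suc m ×ᵣ 1# * suc n ×ᵣ 1#         ≈⟨ -‿involutive _ ⟨
    - - (suc m ×ᵣ 1# * suc n ×ᵣ 1#)   ≈⟨ -‿cong (-‿distribˡ-* _ _) ⟩
    - (- (suc m ×ᵣ 1#) * suc n ×ᵣ 1#) ≈⟨ -‿distribʳ-* _ _ ⟩
    - (suc m ×ᵣ 1#) * - (suc n ×ᵣ 1#) ∎

  ℤ⟶R : ℤ.+-*-rawRing ACR.-Raw-AlmostCommutative⟶ ACR.fromCommutativeRing R
  ℤ⟶R = record
    { ⟦_⟧    = ⟦_⟧ℤ
    ; +-homo = ⟦⟧ℤ-+
    ; *-homo = ⟦⟧ℤ-*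
    ; -‿homo = ⟦⟧ℤ-neg
    ; 0-homo = refl
    ; 1-homo = refl
    }

  ⟦⟧ℤ-≟ : ∀ i j → Maybe (⟦ i ⟧ℤ ≈ ⟦ j ⟧ℤ)
  ⟦⟧ℤ-≟ i j = Maybe.map (λ { ≡.refl → refl }) (dec⇒weaklyDec ℤ._≟_ i j)

  open Algebra.Solver.Ring ℤ.+-*-rawRing (ACR.fromCommutativeRing R) ℤ⟶R ⟦⟧ℤ-≟ public
    using (solve; _:=_; con; _:+_; _:*_; _:-_; :-_)

module LucasSequence {a b : Level} (R : CommutativeRing a b) (t : CommutativeRing.Carrier R) where
  open CommutativeRing R
  open IntegerCoefficientSolver R
  open import Algebra.Definitions.RawMagma *-rawMagma using (_∣_; _,_)
  open import Relation.Binary.Reasoning.Setoid setoid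

  -- V (suc n) is the paper's U n, with t in place of 2x.
  V : ℕ → Carrier
  V zero          = 0#
  V (suc zero)    = 1#
  V (suc (suc n)) = t * V (suc n) - V n

  Vℤ : ℤ → Carrier
  Vℤ (+ n)    = V n
  Vℤ -[1+ n ] = - V (suc n)

  Vℤ-rec : ∀ j → Vℤ (ℤ.suc j) ≈ t * Vℤ j - Vℤ (ℤ.pred j)
  Vℤ-rec (+ zero)     = solve 1 (λ t → con (+ 1) := t :* con (+ 0) :- (:- con (+ 1))) refl t
  Vℤ-rec (+ suc n)    = refl
  Vℤ-rec -[1+ zero ]  = solve 1 (λ t → con (+ 0) := t :* (:- con (+ 1)) :- (:- (t :* con (+ 1) :- con (+ 0)))) refl t
  Vℤ-rec -[1+ suc n ] = solve 3 (λ t x y → :- x := t :* (:- y) :- (:- (t :* y :- x))) refl t (V (suc n)) (V (suc (suc n)))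

  V-+ : ∀ m n → V (suc (m ℕ.+ n)) ≈ V (suc m) * V (suc n) - V m * V n
  V-+ zero    n = solve 2 (λ x y → x := con (+ 1) :* x :- con (+ 0) :* y) refl (V (suc n)) (V n)
  V-+ (suc m) n = begin
    V (suc (suc m ℕ.+ n))                               ≡⟨ ≡.cong (V ∘ suc) (ℕ.+-suc m n) ⟨
    V (suc (m ℕ.+ suc n))                               ≈⟨ V-+ m (suc n) ⟩
    V (suc m) * (t * V (suc n) - V n) - V m * V (suc n)
      ≈⟨ solve 5 (λ t x y z w → x :* (t :* z :- w) :- y :* z := (t :* x :- y) :* z :- x :* w)
                 refl t (V (suc m)) (V m) (V (suc n)) (V n) ⟩
    V (suc (suc m)) * V (suc n) - V (suc m) * V n       ∎

  V-cassini : ∀ n → V (suc n) * V (suc n) - V (suc (suc n)) * V n ≈ 1#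
  V-cassini zero    = solve 1 (λ t → con (+ 1) :* con (+ 1) :- (t :* con (+ 1) :- con (+ 0)) :* con (+ 0) := con (+ 1)) refl t
  V-cassini (suc n) = trans
    (solve 3 (λ t y z → (t :* y :- z) :* (t :* y :- z) :- (t :* (t :* y :- z) :- y) :* y := y :* y :- (t :* y :- z) :* z)
             refl t (V (suc n)) (V n))
    (V-cassini n)

  V∣V[k*m] : ∀ k m → V m ∣ V (k ℕ.* m)
  V∣V[k*m] k       zero    rewrite ℕ.*-zeroʳ k = 1# , *-identityˡ 0#
  V∣V[k*m] zero    (suc m) = 0# , zeroˡ (V (suc m))
  V∣V[k*m] (suc k) (suc m) with q , qV≈V[km] ← V∣V[k*m] k (suc m) = V (suc km) - V m * q , (begin
    (V (suc km) - V m * q) * V (suc m)             ≈⟨ solve 4 (λ x y z w → (x :- y :* z) :* w := w :* x :- y :* (z :* w))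
                                                               refl (V (suc km)) (V m) q (V (suc m)) ⟩
    V (suc m) * V (suc km) - V m * (q * V (suc m)) ≈⟨ +-congˡ (-‿cong (*-congˡ qV≈V[km])) ⟩
    V (suc m) * V (suc km) - V m * V km            ≈⟨ V-+ m km ⟨
    V (suc (m ℕ.+ km))                             ∎)
    where km = k ℕ.* suc m

  Comaximal : Carrier → Carrier → Set (a ⊔ b)
  Comaximal x y = ∃₂ λ A B → A * x + B * y ≈ 1#

  comaximal-sym : ∀ {x y} → Comaximal x y → Comaximal y x
  comaximal-sym (A , B , eq) = B , A , trans (+-comm _ _) eq

  -- V (suc N) = V (x m) is a multiple of V m and V N = V (y n) one of V n, so Cassini's identity
  -- at N writes 1 as a combination of V m and V n.
  suc[y*n]≡x*m⇒V-comaximal : ∀ m n x y → suc (y ℕ.* n) ≡ x ℕ.* m → Comaximal (V m) (V n)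
  suc[y*n]≡x*m⇒V-comaximal m n x y eq
    with q₁ , q₁V≈V[xm] ← V∣V[k*m] x m | q₂ , q₂V≈V[yn] ← V∣V[k*m] y n
    = V (suc N) * q₁ , - (V (suc (suc N)) * q₂) , (begin
    V (suc N) * q₁ * V m + - (V (suc (suc N)) * q₂) * V n
      ≈⟨ solve 6 (λ a b c d e f → a :* b :* c :+ :- (d :* e) :* f := a :* (b :* c) :- d :* (e :* f))
                 refl (V (suc N)) q₁ (V m) (V (suc (suc N))) q₂ (V n) ⟩
    V (suc N) * (q₁ * V m) - V (suc (suc N)) * (q₂ * V n)
      ≈⟨ +-cong (*-congˡ (trans q₁V≈V[xm] (reflexive (≡.cong V (≡.sym eq))))) (-‿cong (*-congˡ q₂V≈V[yn])) ⟩
    V (suc N) * V (suc N) - V (suc (suc N)) * V N         ≈⟨ V-cassini N ⟩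
    1#                                                    ∎)
    where N = y ℕ.* n

  V-comaximal : ∀ {m n} → Coprime m n → Comaximal (V m) (V n)
  V-comaximal {m} {n} c with coprime-Bézout c
  ... | Bézout.+- x y eq = suc[y*n]≡x*m⇒V-comaximal m n x y eq
  ... | Bézout.-+ x y eq = comaximal-sym (suc[y*n]≡x*m⇒V-comaximal n m y x eq)

ℤ-induction₂ : ∀ {p} (P : ℤ → Set p) → P (+ 0) → P (+ 1) →
               (∀ i → P i → P (ℤ.suc i) → P (ℤ.suc (ℤ.suc i))) →
               (∀ i → P i → P (ℤ.suc i) → P (ℤ.pred i)) →
               ∀ i → P i
ℤ-induction₂ P P0 P1 up down = λ where
    (+ n)      → proj₁ (upward n)
    -[1+ n ]   → proj₁ (downward n)
  where
  upward : ∀ n → P (+ n) × P (+ suc n)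
  upward zero    = P0 , P1
  upward (suc n) with Pn , P[1+n] ← upward n = P[1+n] , up (+ n) Pn P[1+n]

  downward : ∀ n → P -[1+ n ] × P (ℤ.suc -[1+ n ])
  downward zero    = down (+ 0) P0 P1 , P0
  downward (suc n) with P[-1-n] , P[-n] ← downward n = down -[1+ n ] P[-1-n] P[-n] , P[-1-n]

module AbelianGroupLemmas {c ℓ : Level} (G : AbelianGroup c ℓ) where
  open AbelianGroup G
  open GroupProperties group
    using (identityʳ-unique; inverseˡ-unique; //-cong₂; //-rightDividesˡ; //-rightDividesʳ)
  open AbelianGroupProperties G using (⁻¹-∙-comm; ⁻¹-anti-homo‿-; xyx⁻¹≈y)
  open import Algebra.Properties.CommutativeSemigroup commutativeSemigroup using (interchange)
  open import Relation.Binary.Reasoning.Setoid setoid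

  module _ {S : Carrier → Carrier} (S-isMagmaHomomorphism : IsMagmaHomomorphism rawMagma rawMagma S) where
    open IsMagmaHomomorphism S-isMagmaHomomorphism renaming (⟦⟧-cong to S-cong; homo to S-∙)

    isMagmaHomomorphism⇒ε-homo : S ε ≈ ε
    isMagmaHomomorphism⇒ε-homo = identityʳ-unique (S ε) (S ε) (trans (sym (S-∙ ε ε)) (S-cong (identityˡ ε)))

    isMagmaHomomorphism⇒⁻¹-homo : ∀ x → S (x ⁻¹) ≈ S x ⁻¹
    isMagmaHomomorphism⇒⁻¹-homo x = inverseˡ-unique (S (x ⁻¹)) (S x) (begin
      S (x ⁻¹) ∙ S x ≈⟨ S-∙ (x ⁻¹) x ⟨
      S (x ⁻¹ ∙ x)   ≈⟨ S-cong (inverseˡ x) ⟩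
      S ε            ≈⟨ isMagmaHomomorphism⇒ε-homo ⟩
      ε              ∎)

  interchange‿- : ∀ a b c d → (a - b) - (c - d) ≈ (a - c) - (b - d)
  interchange‿- a b c d = begin
    (a - b) ∙ (c - d) ⁻¹       ≈⟨ ∙-congˡ (⁻¹-∙-comm c (d ⁻¹)) ⟨
    (a - b) ∙ (c ⁻¹ ∙ d ⁻¹ ⁻¹) ≈⟨ interchange a (b ⁻¹) (c ⁻¹) (d ⁻¹ ⁻¹) ⟩
    (a - c) ∙ (b ⁻¹ ∙ d ⁻¹ ⁻¹) ≈⟨ ∙-congˡ (⁻¹-∙-comm b (d ⁻¹)) ⟩
    (a - c) - (b - d)          ∎

  x-y≈z⇔x≈z∙y : ∀ {x y z} → (x - y ≈ z) ⇔ (x ≈ z ∙ y)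
  x-y≈z⇔x≈z∙y {x} {y} {z} = mk⇔
    (λ x-y≈z → trans (sym (//-rightDividesˡ y x)) (∙-congʳ x-y≈z))
    (λ x≈z∙y → trans (//-cong₂ x≈z∙y refl) (//-rightDividesʳ y z))

  x≈y-z⇒z≈y-x : ∀ {x y z} → x ≈ y - z → z ≈ y - x
  x≈y-z⇒z≈y-x {x} {y} {z} x≈y-z = begin
    z              ≈⟨ xyx⁻¹≈y y z ⟨
    y ∙ z ∙ y ⁻¹   ≈⟨ assoc y z (y ⁻¹) ⟩
    y ∙ (z - y)    ≈⟨ ∙-congˡ (⁻¹-anti-homo‿- y z) ⟨
    y ∙ (y - z) ⁻¹ ≈⟨ ∙-congˡ (⁻¹-cong x≈y-z) ⟨
    y - x          ∎

module PolynomialAction {c ℓ : Level} (G : AbelianGroup c ℓ) (T : AbelianGroup.Carrier G → AbelianGroup.Carrier G)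
  (T-isMagmaHomomorphism : IsMagmaHomomorphism (AbelianGroup.rawMagma G) (AbelianGroup.rawMagma G) T) where
  open AbelianGroup G
  open IsMagmaHomomorphism T-isMagmaHomomorphism renaming (⟦⟧-cong to T-cong; homo to T-∙)
  open GroupProperties group using (ε⁻¹≈ε; ⁻¹-involutive; //-cong₂)
  open AbelianGroupProperties G using (⁻¹-∙-comm)
  open AbelianGroupLemmas G
  open import Algebra.Properties.CommutativeSemigroup commutativeSemigroup using (interchange)
  open import Relation.Binary.Reasoning.Setoid setoid

  -- ℤ[X] acting on G by X ↦ T; identifying polynomials that act alike makes it a commutative ring.
  infixl 6 _+ₚ_
  infixl 7 _*ₚ_
  infix  8 -ₚ_

  data Poly : Set where
    0ₚ 1ₚ X   : Poly
    _+ₚ_ _*ₚ_ : Poly → Poly → Poly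
    -ₚ_       : Poly → Poly

  ⟦_⟧ : Poly → Carrier → Carrier
  ⟦ 0ₚ     ⟧ x = ε
  ⟦ 1ₚ     ⟧ x = x
  ⟦ X      ⟧ x = T x
  ⟦ p +ₚ q ⟧ x = ⟦ p ⟧ x ∙ ⟦ q ⟧ x
  ⟦ p *ₚ q ⟧ x = ⟦ p ⟧ (⟦ q ⟧ x)
  ⟦ -ₚ p   ⟧ x = ⟦ p ⟧ x ⁻¹

  ⟦⟧-cong : ∀ p {x y} → x ≈ y → ⟦ p ⟧ x ≈ ⟦ p ⟧ y
  ⟦⟧-cong 0ₚ       x≈y = refl
  ⟦⟧-cong 1ₚ       x≈y = x≈y
  ⟦⟧-cong X        x≈y = T-cong x≈y
  ⟦⟧-cong (p +ₚ q) x≈y = ∙-cong (⟦⟧-cong p x≈y) (⟦⟧-cong q x≈y)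
  ⟦⟧-cong (p *ₚ q) x≈y = ⟦⟧-cong p (⟦⟧-cong q x≈y)
  ⟦⟧-cong (-ₚ p)   x≈y = ⁻¹-cong (⟦⟧-cong p x≈y)

  ⟦⟧-∙ : ∀ p x y → ⟦ p ⟧ (x ∙ y) ≈ ⟦ p ⟧ x ∙ ⟦ p ⟧ y
  ⟦⟧-∙ 0ₚ       x y = sym (identityˡ ε)
  ⟦⟧-∙ 1ₚ       x y = refl
  ⟦⟧-∙ X        x y = T-∙ x y
  ⟦⟧-∙ (p +ₚ q) x y = trans (∙-cong (⟦⟧-∙ p x y) (⟦⟧-∙ q x y)) (interchange _ _ _ _)
  ⟦⟧-∙ (p *ₚ q) x y = trans (⟦⟧-cong p (⟦⟧-∙ q x y)) (⟦⟧-∙ p _ _)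
  ⟦⟧-∙ (-ₚ p)   x y = trans (⁻¹-cong (⟦⟧-∙ p x y)) (sym (⁻¹-∙-comm _ _))

  ⟦⟧-isMagmaHomomorphism : ∀ p → IsMagmaHomomorphism rawMagma rawMagma ⟦ p ⟧
  ⟦⟧-isMagmaHomomorphism p = record { isRelHomomorphism = record { cong = ⟦⟧-cong p } ; homo = ⟦⟧-∙ p }

  ⟦⟧-ε : ∀ p → ⟦ p ⟧ ε ≈ ε
  ⟦⟧-ε p = isMagmaHomomorphism⇒ε-homo (⟦⟧-isMagmaHomomorphism p)

  ⟦⟧-⁻¹ : ∀ p x → ⟦ p ⟧ (x ⁻¹) ≈ ⟦ p ⟧ x ⁻¹
  ⟦⟧-⁻¹ p = isMagmaHomomorphism⇒⁻¹-homo (⟦⟧-isMagmaHomomorphism p)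

  ⟦⟧-T : ∀ p x → ⟦ p ⟧ (T x) ≈ T (⟦ p ⟧ x)
  ⟦⟧-T 0ₚ       x = sym (isMagmaHomomorphism⇒ε-homo T-isMagmaHomomorphism)
  ⟦⟧-T 1ₚ       x = refl
  ⟦⟧-T X        x = refl
  ⟦⟧-T (p +ₚ q) x = trans (∙-cong (⟦⟧-T p x) (⟦⟧-T q x)) (sym (T-∙ _ _))
  ⟦⟧-T (p *ₚ q) x = trans (⟦⟧-cong p (⟦⟧-T q x)) (⟦⟧-T p _)
  ⟦⟧-T (-ₚ p)   x = trans (⁻¹-cong (⟦⟧-T p x)) (sym (isMagmaHomomorphism⇒⁻¹-homo T-isMagmaHomomorphism _))

  ⟦⟧-comm : ∀ p q x → ⟦ p ⟧ (⟦ q ⟧ x) ≈ ⟦ q ⟧ (⟦ p ⟧ x)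
  ⟦⟧-comm p 0ₚ         x = ⟦⟧-ε p
  ⟦⟧-comm p 1ₚ         x = refl
  ⟦⟧-comm p X          x = ⟦⟧-T p x
  ⟦⟧-comm p (q₁ +ₚ q₂) x = trans (⟦⟧-∙ p _ _) (∙-cong (⟦⟧-comm p q₁ x) (⟦⟧-comm p q₂ x))
  ⟦⟧-comm p (q₁ *ₚ q₂) x = trans (⟦⟧-comm p q₁ _) (⟦⟧-cong q₁ (⟦⟧-comm p q₂ x))
  ⟦⟧-comm p (-ₚ q)     x = trans (⟦⟧-⁻¹ p _) (⁻¹-cong (⟦⟧-comm p q x))

  infix 4 _≋_
  _≋_ : Rel Poly (c ⊔ ℓ)
  p ≋ q = ∀ x → ⟦ p ⟧ x ≈ ⟦ q ⟧ x

  ≋-isCommutativeRing : IsCommutativeRing _≋_ _+ₚ_ _*ₚ_ -ₚ_ 0ₚ 1ₚ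
  ≋-isCommutativeRing = record
    { isRing = record
      { +-isAbelianGroup = record
        { isGroup = record
          { isMonoid = record
            { isSemigroup = record
              { isMagma = record
                { isEquivalence = record
                  { refl  = λ x → refl
                  ; sym   = λ p≋q x → sym (p≋q x)
                  ; trans = λ p≋q q≋r x → trans (p≋q x) (q≋r x)
                  }
                ; ∙-cong = λ p≋p′ q≋q′ x → ∙-cong (p≋p′ x) (q≋q′ x)
                }
              ; assoc = λ p q r x → assoc _ _ _
              }
            ; identity = (λ p x → identityˡ _) , (λ p x → identityʳ _)
            }
          ; inverse = (λ p x → inverseˡ _) , (λ p x → inverseʳ _)
          ; ⁻¹-cong = λ p≋q x → ⁻¹-cong (p≋q x)
          }
        ; comm = λ p q x → comm _ _
        }
      ; *-cong     = λ {p} {p′} {q} {q′} p≋p′ q≋q′ x → trans (⟦⟧-cong p (q≋q′ x)) (p≋p′ (⟦ q′ ⟧ x))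
      ; *-assoc    = λ p q r x → refl
      ; *-identity = (λ p x → refl) , (λ p x → refl)
      ; distrib    = (λ p q r x → ⟦⟧-∙ p _ _) , (λ p q r x → refl)
      }
    ; *-comm = ⟦⟧-comm
    }

  polyRing : CommutativeRing 0ℓ (c ⊔ ℓ)
  polyRing = record { isCommutativeRing = ≋-isCommutativeRing }

  open LucasSequence polyRing X public using (V; Vℤ; Vℤ-rec; Comaximal; V-comaximal)

  T-homo‿- : ∀ x y → T (x - y) ≈ T x - T y
  T-homo‿- x y = trans (T-∙ x (y ⁻¹)) (∙-congˡ (isMagmaHomomorphism⇒⁻¹-homo T-isMagmaHomomorphism y))

  Recurrent : (ℤ → Carrier) → Set ℓ
  Recurrent F = ∀ j → F (ℤ.suc j) ≈ T (F j) - F (ℤ.pred j)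

  module _ {F : ℤ → Carrier} (F-rec : Recurrent F) where

    recurrent-forward : ∀ i → F (ℤ.suc (ℤ.suc i)) ≈ T (F (ℤ.suc i)) - F i
    recurrent-forward i = trans (F-rec (ℤ.suc i)) (∙-congˡ (⁻¹-cong (reflexive (≡.cong F (ℤ.pred-suc i)))))

    recurrent-backward : ∀ i → F (ℤ.pred i) ≈ T (F i) - F (ℤ.suc i)
    recurrent-backward i = x≈y-z⇒z≈y-x (F-rec i)

    recurrent-∘pred : Recurrent (F ∘ ℤ.pred)
    recurrent-∘pred j = trans (reflexive (≡.cong F pred∘suc≡suc∘pred)) (F-rec (ℤ.pred j))
      where
      pred∘suc≡suc∘pred : ℤ.pred (ℤ.suc j) ≡ ℤ.suc (ℤ.pred j)
      pred∘suc≡suc∘pred = ≡.trans (ℤ.pred-suc j) (≡.sym (ℤ.suc-pred j))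

  recurrent-unique : ∀ {F G} → Recurrent F → Recurrent G →
                     F (+ 0) ≈ G (+ 0) → F (+ 1) ≈ G (+ 1) → ∀ j → F j ≈ G j
  recurrent-unique {F} {G} F-rec G-rec F0≈G0 F1≈G1 = ℤ-induction₂ (λ j → F j ≈ G j) F0≈G0 F1≈G1
    (λ i Fi≈Gi F[1+i]≈G[1+i] → same-step (recurrent-forward F-rec i) (recurrent-forward G-rec i) F[1+i]≈G[1+i] Fi≈Gi)
    (λ i Fi≈Gi F[1+i]≈G[1+i] → same-step (recurrent-backward F-rec i) (recurrent-backward G-rec i) Fi≈Gi F[1+i]≈G[1+i])
    where
    same-step : ∀ {x y a b a′ b′} → x ≈ T a - b → y ≈ T a′ - b′ → a ≈ a′ → b ≈ b′ → x ≈ y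
    same-step x≈ y≈ a≈a′ b≈b′ = trans x≈ (trans (//-cong₂ (T-cong a≈a′) b≈b′) (sym y≈))

  recurrent‿- : ∀ {F G} → Recurrent F → Recurrent G → Recurrent (λ j → F j - G j)
  recurrent‿- {F} {G} F-rec G-rec j = begin
    F (ℤ.suc j) - G (ℤ.suc j)                           ≈⟨ //-cong₂ (F-rec j) (G-rec j) ⟩
    (T (F j) - F (ℤ.pred j)) - (T (G j) - G (ℤ.pred j)) ≈⟨ interchange‿- _ _ _ _ ⟩
    (T (F j) - T (G j)) - (F (ℤ.pred j) - G (ℤ.pred j)) ≈⟨ //-cong₂ (T-homo‿- (F j) (G j)) refl ⟨
    T (F j - G j) - (F (ℤ.pred j) - G (ℤ.pred j))       ∎

  closedForm : Carrier → Carrier → ℤ → Carrier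
  closedForm x₀ x₁ j = ⟦ Vℤ j ⟧ x₁ - ⟦ Vℤ (ℤ.pred j) ⟧ x₀

  closedForm-recurrent : ∀ x₀ x₁ → Recurrent (closedForm x₀ x₁)
  closedForm-recurrent x₀ x₁ = recurrent‿- (λ j → Vℤ-rec j x₁) (recurrent-∘pred (λ j → Vℤ-rec j x₀))

  closedForm-0 : ∀ x₀ x₁ → closedForm x₀ x₁ (+ 0) ≈ x₀
  closedForm-0 x₀ x₁ = trans (identityˡ _) (⁻¹-involutive x₀)

  closedForm-1 : ∀ x₀ x₁ → closedForm x₀ x₁ (+ 1) ≈ x₁
  closedForm-1 x₀ x₁ = trans (∙-congˡ ε⁻¹≈ε) (identityʳ x₁)

  closedForm-cong : ∀ {x₀ x₁ y₀ y₁} → x₀ ≈ y₀ → x₁ ≈ y₁ → ∀ j → closedForm x₀ x₁ j ≈ closedForm y₀ y₁ j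
  closedForm-cong x₀≈y₀ x₁≈y₁ j = //-cong₂ (⟦⟧-cong (Vℤ j) x₁≈y₁) (⟦⟧-cong (Vℤ (ℤ.pred j)) x₀≈y₀)

  recurrent⇒closedForm : ∀ {F} → Recurrent F → ∀ j → F j ≈ closedForm (F (+ 0)) (F (+ 1)) j
  recurrent⇒closedForm {F} F-rec = recurrent-unique F-rec (closedForm-recurrent x₀ x₁)
    (sym (closedForm-0 x₀ x₁)) (sym (closedForm-1 x₀ x₁))
    where x₀ = F (+ 0); x₁ = F (+ 1)

  recurrent-value⇔ : ∀ {F f g} → Recurrent F → F (+ 0) ≈ f → ∀ n →
                     (F (+ n) ≈ g) ⇔ (⟦ V n ⟧ (F (+ 1)) ≈ g ∙ ⟦ Vℤ (ℤ.pred (+ n)) ⟧ f)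
  recurrent-value⇔ {F} {f} F-rec F0≈f n = ⇔.trans (mk⇔ (trans (sym Fn≈)) (trans Fn≈)) x-y≈z⇔x≈z∙y
    where
    Fn≈ : F (+ n) ≈ closedForm f (F (+ 1)) (+ n)
    Fn≈ = trans (recurrent⇒closedForm F-rec (+ n)) (closedForm-cong F0≈f refl (+ n))

  comaximal-solvable : ∀ p q {a b} → Comaximal p q → ⟦ p ⟧ a ≈ ⟦ q ⟧ b →
                       ∃ λ φ → ⟦ q ⟧ φ ≈ a × ⟦ p ⟧ φ ≈ b
  comaximal-solvable p q {a} {b} (A , B , Ap+Bq≋1) pa≈qb = ⟦ A ⟧ b ∙ ⟦ B ⟧ a ,
    (begin
      ⟦ q ⟧ (⟦ A ⟧ b ∙ ⟦ B ⟧ a)         ≈⟨ ⟦⟧-through q ⟩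
      ⟦ A ⟧ (⟦ q ⟧ b) ∙ ⟦ B ⟧ (⟦ q ⟧ a) ≈⟨ ∙-congʳ (⟦⟧-cong A pa≈qb) ⟨
      ⟦ A ⟧ (⟦ p ⟧ a) ∙ ⟦ B ⟧ (⟦ q ⟧ a) ≈⟨ Ap+Bq≋1 a ⟩
      a                                 ∎) ,
    (begin
      ⟦ p ⟧ (⟦ A ⟧ b ∙ ⟦ B ⟧ a)         ≈⟨ ⟦⟧-through p ⟩
      ⟦ A ⟧ (⟦ p ⟧ b) ∙ ⟦ B ⟧ (⟦ p ⟧ a) ≈⟨ ∙-congˡ (⟦⟧-cong B pa≈qb) ⟩
      ⟦ A ⟧ (⟦ p ⟧ b) ∙ ⟦ B ⟧ (⟦ q ⟧ b) ≈⟨ Ap+Bq≋1 b ⟩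
      b                                 ∎)
    where
    ⟦⟧-through : ∀ r → ⟦ r ⟧ (⟦ A ⟧ b ∙ ⟦ B ⟧ a) ≈ ⟦ A ⟧ (⟦ r ⟧ b) ∙ ⟦ B ⟧ (⟦ r ⟧ a)
    ⟦⟧-through r = trans (⟦⟧-∙ r _ _) (∙-cong (⟦⟧-comm r A b) (⟦⟧-comm r B a))

  comaximal-injective : ∀ p q {x y} → Comaximal p q → ⟦ p ⟧ x ≈ ⟦ p ⟧ y → ⟦ q ⟧ x ≈ ⟦ q ⟧ y → x ≈ y
  comaximal-injective p q {x} {y} (A , B , Ap+Bq≋1) px≈py qx≈qy = begin
    x                                 ≈⟨ Ap+Bq≋1 x ⟨
    ⟦ A ⟧ (⟦ p ⟧ x) ∙ ⟦ B ⟧ (⟦ q ⟧ x) ≈⟨ ∙-cong (⟦⟧-cong A px≈py) (⟦⟧-cong B qx≈qy) ⟩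
    ⟦ A ⟧ (⟦ p ⟧ y) ∙ ⟦ B ⟧ (⟦ q ⟧ y) ≈⟨ Ap+Bq≋1 y ⟩
    y                                 ∎

  RecurrentThrough : ℕ → ℕ → Carrier → Carrier → Carrier → (ℤ → Carrier) → Set ℓ
  RecurrentThrough k l f g h F = Recurrent F × F (+ 0) ≈ f × F (+ l) ≈ g × F (+ k) ≈ h

  ∃!RecurrentThrough : ℕ → ℕ → Carrier → Carrier → Carrier → Set (c ⊔ ℓ)
  ∃!RecurrentThrough k l f g h = Σ (ℤ → Carrier) λ F → RecurrentThrough k l f g h F ×
    (∀ F′ → RecurrentThrough k l f g h F′ → ∀ j → F′ j ≈ F j)

  coprime⇒∃!RecurrentThrough⇔ :
    ∀ {k l} → Coprime k l → ∀ f g h →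
    (⟦ V k ⟧ (g ∙ ⟦ Vℤ (ℤ.pred (+ l)) ⟧ f) ≈ ⟦ V l ⟧ (h ∙ ⟦ Vℤ (ℤ.pred (+ k)) ⟧ f))
      ⇔ ∃!RecurrentThrough k l f g h
  coprime⇒∃!RecurrentThrough⇔ {k} {l} k⊥l f g h = mk⇔ sufficient necessary
    where
    open Equivalence using (to; from)
    a = g ∙ ⟦ Vℤ (ℤ.pred (+ l)) ⟧ f
    b = h ∙ ⟦ Vℤ (ℤ.pred (+ k)) ⟧ f

    sufficient : ⟦ V k ⟧ a ≈ ⟦ V l ⟧ b → ∃!RecurrentThrough k l f g h
    sufficient Vka≈Vlb with φ , Vlφ≈a , Vkφ≈b ← comaximal-solvable (V k) (V l) (V-comaximal k⊥l) Vka≈Vlb =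
      closedForm f φ , (F-rec , F0≈f , value l Vlφ≈a , value k Vkφ≈b) , unique
      where
      F-rec = closedForm-recurrent f φ
      F0≈f = closedForm-0 f φ

      value : ∀ n {x} → ⟦ V n ⟧ φ ≈ x ∙ ⟦ Vℤ (ℤ.pred (+ n)) ⟧ f → closedForm f φ (+ n) ≈ x
      value n eq = from (recurrent-value⇔ F-rec F0≈f n) (trans (⟦⟧-cong (V n) (closedForm-1 f φ)) eq)

      unique : ∀ F′ → RecurrentThrough k l f g h F′ → ∀ j → F′ j ≈ closedForm f φ j
      unique F′ (F′-rec , F′0≈f , F′l≈g , F′k≈h) j =
        trans (recurrent⇒closedForm F′-rec j) (closedForm-cong F′0≈f F′1≈φ j)
        where
        F′1≈φ = comaximal-injective (V k) (V l) (V-comaximal k⊥l)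
          (trans (to (recurrent-value⇔ F′-rec F′0≈f k) F′k≈h) (sym Vkφ≈b))
          (trans (to (recurrent-value⇔ F′-rec F′0≈f l) F′l≈g) (sym Vlφ≈a))

    necessary : ∃!RecurrentThrough k l f g h → ⟦ V k ⟧ a ≈ ⟦ V l ⟧ b
    necessary (F , (F-rec , F0≈f , Fl≈g , Fk≈h) , _) = begin
      ⟦ V k ⟧ a                   ≈⟨ ⟦⟧-cong (V k) (to (recurrent-value⇔ F-rec F0≈f l) Fl≈g) ⟨
      ⟦ V k ⟧ (⟦ V l ⟧ (F (+ 1))) ≈⟨ ⟦⟧-comm (V k) (V l) (F (+ 1)) ⟩
      ⟦ V l ⟧ (⟦ V k ⟧ (F (+ 1))) ≈⟨ ⟦⟧-cong (V l) (to (recurrent-value⇔ F-rec F0≈f k) Fk≈h) ⟩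
      ⟦ V l ⟧ b                   ∎

module TreeWaves {c ℓ : Level} (K : CharZeroField c ℓ) (q : ℕ) where
  open CharZeroField K
  open Tree K q
  open IntegerCoefficientSolver commutativeRing
  open RingProperties ring using (-0#≈0#)

  𝓕-group : AbelianGroup c ℓ
  𝓕-group = Pointwise.abelianGroup (Vertex q) +-abelianGroup

  sum : List Carrier → Carrier
  sum = foldr _+_ 0#

  sum-map-cong : ∀ {f g : 𝓕} → f ≈𝓕 g → ∀ vs → sum (map f vs) ≈ sum (map g vs)
  sum-map-cong f≈g []       = refl
  sum-map-cong f≈g (v ∷ vs) = +-cong (f≈g v) (sum-map-cong f≈g vs)

  sum-map-⊕ : ∀ f g vs → sum (map (f ⊕ g) vs) ≈ sum (map f vs) + sum (map g vs)
  sum-map-⊕ f g []       = sym (+-identityʳ 0#)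
  sum-map-⊕ f g (v ∷ vs) = trans (+-congˡ (sum-map-⊕ f g vs)) (interchange _ _ _ _)
    where open import Algebra.Properties.CommutativeSemigroup +-commutativeSemigroup using (interchange)

  2μ₁ : 𝓕 → 𝓕
  2μ₁ f = two · μ₁ f

  2μ₁-cong : ∀ {f g} → f ≈𝓕 g → 2μ₁ f ≈𝓕 2μ₁ g
  2μ₁-cong f≈g v = *-congˡ (*-congˡ (sum-map-cong f≈g (neighbours v)))

  2μ₁-⊕ : ∀ f g → 2μ₁ (f ⊕ g) ≈𝓕 (2μ₁ f ⊕ 2μ₁ g)
  2μ₁-⊕ f g v = trans (*-congˡ (trans (*-congˡ (sum-map-⊕ f g (neighbours v))) (distribˡ _ _ _))) (distribˡ _ _ _)

  2μ₁-isMagmaHomomorphism : IsMagmaHomomorphism (AbelianGroup.rawMagma 𝓕-group) (AbelianGroup.rawMagma 𝓕-group) 2μ₁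
  2μ₁-isMagmaHomomorphism = record { isRelHomomorphism = record { cong = 2μ₁-cong } ; homo = 2μ₁-⊕ }

  open PolynomialAction 𝓕-group 2μ₁ 2μ₁-isMagmaHomomorphism public
  open AbelianGroup 𝓕-group using () renaming (refl to 𝓕-refl; sym to 𝓕-sym; trans to 𝓕-trans; ∙-cong to ⊕-cong)
  open GroupProperties (AbelianGroup.group 𝓕-group) using () renaming (//-cong₂ to ⊖-cong)

  half : Carrier
  half = recipSuc 1

  halving⇔ : ∀ {m x y} → (m ≈ half * (x + y)) ⇔ (x ≈ two * m - y)
  halving⇔ {m} {x} {y} = mk⇔
    (λ m≈ → begin
      x                          ≈⟨ solve 2 (λ x y → x := con (+ 1) :* (x :+ y) :- y) refl x y ⟩
      1# * (x + y) - y           ≈⟨ +-congʳ (*-congʳ two*half≈1) ⟨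
      (two * half) * (x + y) - y ≈⟨ solve 4 (λ t h x y → (t :* h) :* (x :+ y) :- y := t :* (h :* (x :+ y)) :- y) refl two half x y ⟩
      two * (half * (x + y)) - y ≈⟨ +-congʳ (*-congˡ m≈) ⟨
      two * m - y                ∎)
    (λ x≈ → begin
      m                          ≈⟨ solve 1 (λ m → m := con (+ 1) :* m) refl m ⟩
      1# * m                     ≈⟨ *-congʳ two*half≈1 ⟨
      (two * half) * m           ≈⟨ solve 4 (λ t h m y → (t :* h) :* m := h :* ((t :* m :- y) :+ y)) refl two half m y ⟩
      half * ((two * m - y) + y) ≈⟨ *-congˡ (+-congʳ x≈) ⟨
      half * (x + y)             ∎)
    where
    open import Relation.Binary.Reasoning.Setoid setoid
    two*half≈1 : two * half ≈ 1#
    two*half≈1 = proj₂ (inverse two (charZero 1))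

  isWave⇔recurrent : ∀ F → IsWave F ⇔ Recurrent F
  isWave⇔recurrent F = mk⇔
    (λ wave j v → reindex (j+1≡suc[j] j) (j-1≡pred[j] j) (to halving⇔ (wave j v)))
    (λ rec j v → from halving⇔ (reindex (≡.sym (j+1≡suc[j] j)) (≡.sym (j-1≡pred[j] j)) (rec j v)))
    where
    open Equivalence using (to; from)
    reindex : ∀ {j v i₁ i₁′ i₂ i₂′} → i₁ ≡ i₁′ → i₂ ≡ i₂′ →
              F i₁ v ≈ two * μ₁ (F j) v - F i₂ v → F i₁′ v ≈ two * μ₁ (F j) v - F i₂′ v
    reindex ≡.refl ≡.refl eq = eq
    j+1≡suc[j] : ∀ j → j ℤ.+ + 1 ≡ ℤ.suc j
    j+1≡suc[j] j = ℤ.+-comm j (+ 1)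
    j-1≡pred[j] : ∀ j → j ℤ.- + 1 ≡ ℤ.pred j
    j-1≡pred[j] j = ℤ.+-comm j -[1+ 0 ]

  Uℕ≈⟦V∘suc⟧ : ∀ n f → Uℕ n f ≈𝓕 ⟦ V (suc n) ⟧ f
  Uℕ≈⟦V∘suc⟧ zero          f = 𝓕-refl
  Uℕ≈⟦V∘suc⟧ (suc zero)    f v = sym (trans (+-congˡ -0#≈0#) (+-identityʳ _))
  Uℕ≈⟦V∘suc⟧ (suc (suc n)) f = ⊖-cong (2μ₁-cong (Uℕ≈⟦V∘suc⟧ (suc n) f)) (Uℕ≈⟦V∘suc⟧ n f)

  U[m-1]≈⟦V[m]⟧ : ∀ m f → U (+ m ℤ.- + 1) f ≈𝓕 ⟦ V m ⟧ f
  U[m-1]≈⟦V[m]⟧ zero    f = 𝓕-refl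
  U[m-1]≈⟦V[m]⟧ (suc m) f = Uℕ≈⟦V∘suc⟧ m f

  U[m-2]≈⟦V[m-1]⟧ : ∀ m f → U (+ m ℤ.- + 2) f ≈𝓕 ⟦ Vℤ (ℤ.pred (+ m)) ⟧ f
  U[m-2]≈⟦V[m-1]⟧ zero          f = 𝓕-refl
  U[m-2]≈⟦V[m-1]⟧ (suc zero)    f = 𝓕-refl
  U[m-2]≈⟦V[m-1]⟧ (suc (suc m)) f = Uℕ≈⟦V∘suc⟧ m f

  condition⇔ : ∀ k l f g h →
    (U (+ k ℤ.- + 1) (g ⊕ U (+ l ℤ.- + 2) f) ≈𝓕 U (+ l ℤ.- + 1) (h ⊕ U (+ k ℤ.- + 2) f))
      ⇔ (⟦ V k ⟧ (g ⊕ ⟦ Vℤ (ℤ.pred (+ l)) ⟧ f) ≈𝓕 ⟦ V l ⟧ (h ⊕ ⟦ Vℤ (ℤ.pred (+ k)) ⟧ f))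
  condition⇔ k l f g h = mk⇔ (λ e → 𝓕-trans (𝓕-sym (lhs k l g)) (𝓕-trans e (lhs l k h)))
                            (λ e → 𝓕-trans (lhs k l g) (𝓕-trans e (𝓕-sym (lhs l k h))))
    where
    lhs : ∀ m n x → U (+ m ℤ.- + 1) (x ⊕ U (+ n ℤ.- + 2) f) ≈𝓕 ⟦ V m ⟧ (x ⊕ ⟦ Vℤ (ℤ.pred (+ n)) ⟧ f)
    lhs m n x = 𝓕-trans (U[m-1]≈⟦V[m]⟧ m _) (⟦⟧-cong (V m) (⊕-cong 𝓕-refl (U[m-2]≈⟦V[m-1]⟧ n f)))

  ∃!RecurrentThrough⇔∃!Wave : ∀ k l f g h → ∃!RecurrentThrough k l f g h ⇔ ∃!Wave k l f g h
  ∃!RecurrentThrough⇔∃!Wave k l f g h = mk⇔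
    (λ where (F , (F-rec , F-values) , unique) →
               F , (from (isWave⇔recurrent F) F-rec , F-values) ,
               λ where F′ (F′-wave , F′-values) → unique F′ (to (isWave⇔recurrent F′) F′-wave , F′-values))
    (λ where (F , (F-wave , F-values) , unique) →
               F , (to (isWave⇔recurrent F) F-wave , F-values) ,
               λ where F′ (F′-rec , F′-values) → unique F′ (from (isWave⇔recurrent F′) F′-rec , F′-values))
    where open Equivalence using (to; from)

open import Data.Integer using (_-_)

theorem5p5 : ∀ {c ℓ} (K : CharZeroField c ℓ) (q : ℕ) → 1 ≤ q →
    (k l : ℕ) → 1 ≤ k → 1 ≤ l → Coprime k l →
    let open Tree K q in
    (f g h : 𝓕) →
      ((U (+ k - + 1) (g ⊕ U (+ l - + 2) f) ≈𝓕 U (+ l - + 1) (h ⊕ U (+ k - + 2) f))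
        ⇔ ∃!Wave k l f g h)
theorem5p5 K q _ k l _ _ k⊥l f g h =
  ⇔.trans (condition⇔ k l f g h)
    (⇔.trans (coprime⇒∃!RecurrentThrough⇔ k⊥l f g h) (∃!RecurrentThrough⇔∃!Wave k l f g h))
  where open TreeWaves K q
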